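{- For every context-free process $P$ there exists a pushdown automaton $\mathcal{M}$ such that the transition system $\mathcal{T}(P)$ is strongly bisimilar to the pushdown process $\mathcal{T}(\mathcal{M})$.
   Context: $\mathcal{A}_\tau=\mathcal{A}\cup\{\tau\}$ is a set of action labels. $\mathrm{TSP}^{\bullet}$ process expressions: $P::=\mathbf{0}\mid\mathbf{1}\mid a.P\mid P_1\bullet P_2\mid P_1+P_2\mid N$ with $a\in\mathcal{A}_\tau$ and $N$ a name from a recursive specification (a set of equations $N\overset{\mathrm{def}}{=}P$, at most one per name, every name used being defined). A specification is guarded if every summand that is not $\mathbf{1}$ is in the scope of an action prefix. Semantics: $\mathbf{1}\downarrow$; $a.P\xrightarrow{a}P$; $P_1+P_2$ does every transition of $P_1$ and of $P_2$ and terminates if $P_1\downarrow$ or $P_2\downarrow$; $P_1\bullet P_2\downarrow$ if $P_1\downarrow$ and $P_2\downarrow$; if $P_1\xrightarrow{a}P_1'$ then $P_1\bullet P_2\xrightarrow{a}P_1'\bullet P_2$; if $P_1\downarrow$, $P_2\xrightarrow{a}P_2'$ and $P_1$ has no outgoing transitions then $P_1\bullet P_2\xrightarrow{a}P_2'$; a name has exactly the transitions and termination of the right-hand side of its defining equation. $\mathcal{T}(P)$ has as states the expressions reachable from $P$, the induced transitions, initial state $P$, and final states those with $\downarrow$. A context-free process is the strong-bisimilarity class of the transition system generated by (a name of) a finite guarded recursive specification over $\mathrm{TSP}^{\bullet}$. A pushdown automaton is a tuple $(\mathcal{S},\Sigma,\mathcal{D},\to,\uparrow,Z,\downarrow)$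 with $\mathcal{S}$ a finite set of states, $\Sigma\subseteq\mathcal{A}_\tau$ a finite set of input symbols, $\mathcal{D}$ a finite set of stack symbols, $\to\subseteq\mathcal{S}\times\mathcal{D}\times\Sigma\times\mathcal{D}^*\times\mathcal{S}$ a finite transition relation (write $s\xrightarrow{a[d/\delta]}t$), initial state $\uparrow\in\mathcal{S}$, initial stack symbol $Z\in\mathcal{D}$, and accepting states $\downarrow\subseteq\mathcal{S}$. Its pushdown process $\mathcal{T}(\mathcal{M})$ has states all pairs $(s,\delta)\in\mathcal{S}\times\mathcal{D}^*$, transitions $(s,d\delta)\xrightarrow{a}(t,\delta'\delta)$ iff $s\xrightarrow{a[d/\delta']}t$, initial state $(\uparrow,Z)$, and final states $\{(s,\delta)\mid s\in\downarrow\}$. Strong bisimilarity: a symmetric relation $R$ such that $s\,R\,t$ and $s\xrightarrow{a}s'$ imply $t\xrightarrow{a}t'$ with $s'\,R\,t'$, and $s\downarrow$ implies $t\downarrow$; two transition systems are strongly bisimilar if their initial states are so related in their disjoint union. -}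

module Defs where

open import Data.Nat using (ℕ)
open import Data.Fin using (Fin)
open import Data.Fin.Subset using (Subset; _∈_)
open import Data.List using (List; _∷_; _++_)
open import Data.List.Membership.Propositional renaming (_∈_ to _∈ₗ_)
open import Data.Product using (Σ; _×_; _,_)
open import Data.Sum using (_⊎_)
open import Data.Empty using (⊥)
open import Data.Unit using (⊤)
open import Relation.Nullary using (¬_)
open import Relation.Binary.PropositionalEquality using (_≡_)

data Act (A : Set) : Set where
  act : A → Act A
  τ   : Act A

data Exp (A : Set) (n : ℕ) : Set where
  𝟘    : Exp A n
  𝟙    : Exp A n
  pre  : Act A → Exp A n → Exp A n
  _⊙_  : Exp A n → Exp A n → Exp A n
  _⊕_  : Exp A n → Exp A n → Exp A n
  name : Fin n → Exp A n

-- Every occurrence of a name is in the scope of an action prefix.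
data Guarded {A : Set} {n : ℕ} : Exp A n → Set where
  g𝟘   : Guarded 𝟘
  g𝟙   : Guarded 𝟙
  gpre : ∀ a P → Guarded (pre a P)
  g⊙   : ∀ {P Q} → Guarded P → Guarded Q → Guarded (P ⊙ Q)
  g⊕   : ∀ {P Q} → Guarded P → Guarded Q → Guarded (P ⊕ Q)

record GuardedSpec (A : Set) (n : ℕ) : Set where
  field
    rhs     : Fin n → Exp A n
    guarded : ∀ N → Guarded (rhs N)

record LTS (L : Set) : Set₁ where
  field
    State : Set
    Trans : State → L → State → Set
    Final : State → Set
    start : State

record IsBisimulation {L : Set} (T U : LTS L)
         (R : LTS.State T → LTS.State U → Set) : Set where
  private
    module T = LTS T
    module U = LTS U
  field
    zig   : ∀ {s t a s'} → R s t → T.Trans s a s' →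
              Σ U.State λ t' → U.Trans t a t' × R s' t'
    zag   : ∀ {s t a t'} → R s t → U.Trans t a t' →
              Σ T.State λ s' → T.Trans s a s' × R s' t'
    termˡ : ∀ {s t} → R s t → T.Final s → U.Final t
    termʳ : ∀ {s t} → R s t → U.Final t → T.Final s

Bisimilar : {L : Set} → LTS L → LTS L → Set₁
Bisimilar T U = Σ (LTS.State T → LTS.State U → Set) λ R →
  IsBisimulation T U R × R (LTS.start T) (LTS.start U)

-- StepG / TermG give the semantics of a (completely) guarded expression,
-- by recursion on the guardedness proof; Step / Term give the semantics of
-- arbitrary expressions, where a name behaves as its right-hand side.

module Semantics {A : Set} {n : ℕ} (E : GuardedSpec A n) where
  open GuardedSpec E

  mutual
    TermG : (P : Exp A n) → Guarded P → Set
    TermG .𝟘 g𝟘 = ⊥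
    TermG .𝟙 g𝟙 = ⊤
    TermG .(pre a P) (gpre a P) = ⊥
    TermG .(_ ⊙ _) (g⊙ g h) = TermG _ g × TermG _ h
    TermG .(_ ⊕ _) (g⊕ g h) = TermG _ g ⊎ TermG _ h

    StepG : (P : Exp A n) → Guarded P → Act A → Exp A n → Set
    StepG .𝟘 g𝟘 a R = ⊥
    StepG .𝟙 g𝟙 a R = ⊥
    StepG .(pre b P) (gpre b P) a R = (b ≡ a) × (R ≡ P)
    StepG .(P ⊙ Q) (g⊙ {P} {Q} g h) a R =
      (Σ (Exp A n) λ P' → StepG P g a P' × (R ≡ (P' ⊙ Q)))
      ⊎ (TermG P g × (∀ b P' → ¬ StepG P g b P') × StepG Q h a R)
    StepG .(_ ⊕ _) (g⊕ g h) a R = StepG _ g a R ⊎ StepG _ h a R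

  Term : Exp A n → Set
  Term 𝟘 = ⊥
  Term 𝟙 = ⊤
  Term (pre a P) = ⊥
  Term (P ⊙ Q) = Term P × Term Q
  Term (P ⊕ Q) = Term P ⊎ Term Q
  Term (name N) = TermG (rhs N) (guarded N)

  Step : Exp A n → Act A → Exp A n → Set
  Step 𝟘 a R = ⊥
  Step 𝟙 a R = ⊥
  Step (pre b P) a R = (b ≡ a) × (R ≡ P)
  Step (P ⊙ Q) a R =
    (Σ (Exp A n) λ P' → Step P a P' × (R ≡ (P' ⊙ Q)))
    ⊎ (Term P × (∀ b P' → ¬ Step P b P') × Step Q a R)
  Step (P ⊕ Q) a R = Step P a R ⊎ Step Q a R
  Step (name N) a R = StepG (rhs N) (guarded N) a R

-- 𝒯(N): the transition system generated by name N of the specification E.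
-- (States: all expressions; only those reachable from N matter for
-- bisimilarity of initial states.)
𝒯 : {A : Set} {n : ℕ} → GuardedSpec A n → Fin n → LTS (Act A)
𝒯 {A} {n} E N = record
  { State = Exp A n
  ; Trans = Step
  ; Final = Term
  ; start = name N
  }
  where open Semantics E

-- Pushdown automata: states Fin nS, stack symbols Fin nD, a finite list of
-- transitions (s , d , a , δ , t) meaning  s --a[d/δ]--> t.

record PDA (A : Set) : Set where
  field
    nS     : ℕ
    nD     : ℕ
    trans  : List (Fin nS × Fin nD × Act A × List (Fin nD) × Fin nS)
    init   : Fin nS
    Z      : Fin nD
    accept : Subset nS

𝒯ᴾ : {A : Set} → PDA A → LTS (Act A)
𝒯ᴾ {A} M = record
  { State = Fin nS × List (Fin nD)
  ; Trans = λ { (s , stk) a (t , stk') →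
      Σ (Fin nD) λ d → Σ (List (Fin nD)) λ δ → Σ (List (Fin nD)) λ δ' →
        (stk ≡ d ∷ δ) × ((s , d , a , δ' , t) ∈ₗ trans) × (stk' ≡ δ' ++ δ) }
  ; Final = λ { (s , _) → s ∈ accept }
  ; start = (init , Z ∷ [])
  }
  where open PDA M
        open Data.List using ([])

-- A reachable process is a sequential composition of subterms of right-hand
-- sides (and names), so it is encoded as a stack of such "symbols", the top
-- one being the active component.  Symbols denoting terminated processes
-- without transitions are never pushed; hence every transition of the
-- composition is a transition of the top symbol, which replaces it by a
-- finite list of new symbols, computed from the guarded right-hand sides by
-- unfolding names once.  Termination of the whole composition is not visible
-- on the top symbol, so every stack symbol also records whether everything
-- below it terminates, and the automaton's state records whether the whole
-- stack does.  An initial process that is terminated and has no transitions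
-- would leave the stack empty; it is handled separately, by an automaton
-- without transitions.
module Submission where

open import Defs
open import Data.Bool using (Bool; true; false; T; _∧_; if_then_else_)
open import Data.Bool.Properties using (T-∧)
open import Data.Empty using (⊥; ⊥-elim)
open import Data.Fin using (Fin; zero; suc)
open import Data.Fin.Subset using (Subset; ⁅_⁆)
  renaming (_∈_ to _∈ₛ_; ⊤ to ⊤ₛ; ⊥ to ⊥ₛ)
open import Data.Fin.Subset.Properties using (∈⊤; ∉⊥; x∈⁅x⁆; x∈⁅y⁆⇒x≡y)
open import Data.List using (List; []; _∷_; _++_; map; concatMap; foldr; allFin; lookup; length; cartesianProduct)
open import Data.List.Membership.Propositional using (_∈_; find; lose)
open import Data.List.Membership.Propositional.Properties
  using (∈-map⁺; ∈-map⁻; ∈-++⁺ˡ; ∈-++⁺ʳ; ∈-++⁻; ∈-concatMap⁺; ∈-concatMap⁻; ∈-allFin; ∈-cartesianProduct⁺)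
open import Data.List.Properties using (∷-injective; ++-assoc; ++-identityʳ; foldr-++)
open import Data.List.Relation.Unary.Any using (here; there; index)
open import Data.List.Relation.Unary.Any.Properties using (lookup-index)
open import Data.Nat using (ℕ; zero; suc)
open import Data.Product using (Σ; _×_; _,_; proj₁; proj₂; map₁; map₂)
open import Data.Sum using (_⊎_; inj₁; inj₂)
open import Data.Unit using (⊤; tt)
open import Function.Base using (case_of_)
open import Function.Bundles using (_⇔_; mk⇔; Equivalence)
open import Relation.Nullary using (¬_; Dec; yes; no; does; _×-dec_; _⊎-dec_; ¬?)
open import Relation.Nullary.Decidable using (map′; isYes; toWitness; fromWitness)
open import Relation.Binary.PropositionalEquality
  using (_≡_; refl; sym; cong; cong₂; subst; module ≡-Reasoning)

open Equivalence using (to; from)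

module Enumeration {X : Set} (xs : List X) (complete : ∀ x → x ∈ xs) where

  encode : X → Fin (length xs)
  encode x = index (complete x)

  encode-injective : ∀ {x y} → encode x ≡ encode y → x ≡ y
  encode-injective {x} {y} e = begin
    x                    ≡⟨ lookup-index (complete x) ⟩
    lookup xs (encode x) ≡⟨ cong (lookup xs) e ⟩
    lookup xs (encode y) ≡⟨ lookup-index (complete y) ⟨
    y                    ∎
    where open ≡-Reasoning

∈-booleans : (b : Bool) → b ∈ true ∷ false ∷ []
∈-booleans true  = here refl
∈-booleans false = there (here refl)

inert-bisimilar : ∀ {A} (𝕋 : LTS (Act A)) → let open LTS 𝕋 in
                  (∀ {a s} → ¬ Trans start a s) → Dec (Final start) →
                  Σ (PDA A) λ M → Bisimilar 𝕋 (𝒯ᴾ M)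
inert-bisimilar {A} 𝕋 inert final? = M , (λ s _ → s ≡ start) , isBisimulation , refl
  where
  open LTS 𝕋

  accepting : Bool → Subset 1
  accepting b = if b then ⊤ₛ else ⊥ₛ

  M : PDA A
  M = record { nS = 1 ; nD = 1 ; trans = [] ; init = zero ; Z = zero
             ; accept = accepting (does final?) }

  termˡ : ∀ d {s c} → s ≡ start → Final s → c ∈ₛ accepting (does d)
  termˡ (yes _) _    _ = ∈⊤
  termˡ (no ¬f) refl f = ⊥-elim (¬f f)

  termʳ : ∀ d {s c} → s ≡ start → c ∈ₛ accepting (does d) → Final s
  termʳ (yes f) refl _  = f
  termʳ (no _)  _    c∈ = ⊥-elim (∉⊥ c∈)

  isBisimulation : IsBisimulation 𝕋 (𝒯ᴾ M) (λ s _ → s ≡ start)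
  isBisimulation = record
    { zig   = λ { refl t → ⊥-elim (inert t) }
    ; zag   = λ { _ (_ , _ , _ , _ , () , _) }
    ; termˡ = termˡ final?
    ; termʳ = termʳ final?
    }

module _ {A : Set} {n : ℕ} where

  data Pos : Exp A n → Set where
    here  : ∀ {P} → Pos P
    under : ∀ {a P} → Pos P → Pos (pre a P)
    seqˡ  : ∀ {P Q} → Pos P → Pos (P ⊙ Q)
    seqʳ  : ∀ {P Q} → Pos Q → Pos (P ⊙ Q)
    sumˡ  : ∀ {P Q} → Pos P → Pos (P ⊕ Q)
    sumʳ  : ∀ {P Q} → Pos Q → Pos (P ⊕ Q)

  subterm : ∀ {P} → Pos P → Exp A n
  subterm {P} here = P
  subterm (under q) = subterm q
  subterm (seqˡ q)  = subterm q
  subterm (seqʳ q)  = subterm q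
  subterm (sumˡ q)  = subterm q
  subterm (sumʳ q)  = subterm q

  _⨾_ : ∀ {P} (q : Pos P) → Pos (subterm q) → Pos P
  here   ⨾ r = r
  under q ⨾ r = under (q ⨾ r)
  seqˡ q ⨾ r = seqˡ (q ⨾ r)
  seqʳ q ⨾ r = seqʳ (q ⨾ r)
  sumˡ q ⨾ r = sumˡ (q ⨾ r)
  sumʳ q ⨾ r = sumʳ (q ⨾ r)

  subterm-⨾ : ∀ {P} (q : Pos P) (r : Pos (subterm q)) → subterm (q ⨾ r) ≡ subterm r
  subterm-⨾ here      r = refl
  subterm-⨾ (under q) r = subterm-⨾ q r
  subterm-⨾ (seqˡ q)  r = subterm-⨾ q r
  subterm-⨾ (seqʳ q)  r = subterm-⨾ q r
  subterm-⨾ (sumˡ q)  r = subterm-⨾ q r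
  subterm-⨾ (sumʳ q)  r = subterm-⨾ q r

  positions : (P : Exp A n) → List (Pos P)
  properPositions : (P : Exp A n) → List (Pos P)
  positions P = here ∷ properPositions P
  properPositions 𝟘         = []
  properPositions 𝟙         = []
  properPositions (pre a P) = map under (positions P)
  properPositions (P ⊙ Q)   = map seqˡ (positions P) ++ map seqʳ (positions Q)
  properPositions (P ⊕ Q)   = map sumˡ (positions P) ++ map sumʳ (positions Q)
  properPositions (name M)  = []

  ∈-positions : ∀ {P} (q : Pos P) → q ∈ positions P
  ∈-positions here = here refl
  ∈-positions (under q) = there (∈-map⁺ under (∈-positions q))
  ∈-positions (seqˡ q) = there (∈-++⁺ˡ (∈-map⁺ seqˡ (∈-positions q)))
  ∈-positions (seqʳ {P} q) = there (∈-++⁺ʳ (map seqˡ (positions P)) (∈-map⁺ seqʳ (∈-positions q)))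
  ∈-positions (sumˡ q) = there (∈-++⁺ˡ (∈-map⁺ sumˡ (∈-positions q)))
  ∈-positions (sumʳ {P} q) = there (∈-++⁺ʳ (map sumˡ (positions P)) (∈-map⁺ sumʳ (∈-positions q)))

module Construction {A : Set} {n : ℕ} (E : GuardedSpec A n) where
  open GuardedSpec E
  open Semantics E

  Inert : Exp A n → Set
  Inert P = ∀ a P' → ¬ Step P a P'

  Dead : Exp A n → Set
  Dead P = Term P × Inert P

  CanStep : Exp A n → Set
  CanStep P = Σ (Act A) λ a → Σ (Exp A n) λ P' → Step P a P'

  termG⇔term : ∀ {P} (g : Guarded P) → TermG P g ⇔ Term P
  termG⇔term g𝟘 = mk⇔ (λ ()) (λ ())
  termG⇔term g𝟙 = mk⇔ (λ t → t) (λ t → t)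
  termG⇔term (gpre a P) = mk⇔ (λ ()) (λ ())
  termG⇔term (g⊙ g h) = mk⇔ (λ (s , t) → to (termG⇔term g) s , to (termG⇔term h) t)
                            (λ (s , t) → from (termG⇔term g) s , from (termG⇔term h) t)
  termG⇔term (g⊕ g h) = mk⇔ (λ { (inj₁ s) → inj₁ (to (termG⇔term g) s)
                                ; (inj₂ t) → inj₂ (to (termG⇔term h) t) })
                            (λ { (inj₁ s) → inj₁ (from (termG⇔term g) s)
                                ; (inj₂ t) → inj₂ (from (termG⇔term h) t) })

  stepG⇔step : ∀ {P} (g : Guarded P) {a R} → StepG P g a R ⇔ Step P a R
  stepG⇔step g𝟘 = mk⇔ (λ ()) (λ ())
  stepG⇔step g𝟙 = mk⇔ (λ ()) (λ ())
  stepG⇔step (gpre a P) = mk⇔ (λ s → s) (λ s → s)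
  stepG⇔step (g⊙ g h) = mk⇔
    (λ { (inj₁ (P' , s , e)) → inj₁ (P' , to (stepG⇔step g) s , e)
       ; (inj₂ (t , i , s)) → inj₂ ( to (termG⇔term g) t
                                   , (λ b P' s' → i b P' (from (stepG⇔step g) s'))
                                   , to (stepG⇔step h) s) })
    (λ { (inj₁ (P' , s , e)) → inj₁ (P' , from (stepG⇔step g) s , e)
       ; (inj₂ (t , i , s)) → inj₂ ( from (termG⇔term g) t
                                   , (λ b P' s' → i b P' (to (stepG⇔step g) s'))
                                   , from (stepG⇔step h) s) })
  stepG⇔step (g⊕ g h) = mk⇔
    (λ { (inj₁ s) → inj₁ (to (stepG⇔step g) s) ; (inj₂ s) → inj₂ (to (stepG⇔step h) s) })
    (λ { (inj₁ s) → inj₁ (from (stepG⇔step g) s) ; (inj₂ s) → inj₂ (from (stepG⇔step h) s) })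

  -- Fuel for the recursions below: a name outside every prefix costs one
  -- unit to unfold; one unit suffices because right-hand sides are guarded.
  Unfolds : ℕ → Exp A n → Set
  Unfolds k (P ⊙ Q) = Unfolds k P × Unfolds k Q
  Unfolds k (P ⊕ Q) = Unfolds k P × Unfolds k Q
  Unfolds zero (name M) = ⊥
  Unfolds _ _ = ⊤

  guarded⇒unfolds : ∀ {k P} → Guarded P → Unfolds k P
  guarded⇒unfolds g𝟘 = tt
  guarded⇒unfolds g𝟙 = tt
  guarded⇒unfolds (gpre a P) = tt
  guarded⇒unfolds (g⊙ g h) = guarded⇒unfolds g , guarded⇒unfolds h
  guarded⇒unfolds (g⊕ g h) = guarded⇒unfolds g , guarded⇒unfolds h

  unfolds-suc : ∀ {k} P → Unfolds (suc k) P
  unfolds-suc 𝟘 = tt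
  unfolds-suc 𝟙 = tt
  unfolds-suc (pre a P) = tt
  unfolds-suc (P ⊙ Q) = unfolds-suc P , unfolds-suc Q
  unfolds-suc (P ⊕ Q) = unfolds-suc P , unfolds-suc Q
  unfolds-suc (name M) = tt

  canStep-⊙ : ∀ {P Q} → ¬ CanStep P → Term P → CanStep Q → CanStep (P ⊙ Q)
  canStep-⊙ ¬p t (a , Q' , s) = a , Q' , inj₂ (t , (λ b P' s' → ¬p (b , P' , s')) , s)

  term?ᵘ : ∀ k P → Unfolds k P → Dec (Term P)
  term?ᵘ k 𝟘 _ = no λ ()
  term?ᵘ k 𝟙 _ = yes tt
  term?ᵘ k (pre a P) _ = no λ ()
  term?ᵘ k (P ⊙ Q) (u , v) = term?ᵘ k P u ×-dec term?ᵘ k Q v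
  term?ᵘ k (P ⊕ Q) (u , v) = term?ᵘ k P u ⊎-dec term?ᵘ k Q v
  term?ᵘ zero (name M) ()
  term?ᵘ (suc k) (name M) _ =
    map′ (from (termG⇔term (guarded M))) (to (termG⇔term (guarded M)))
         (term?ᵘ k (rhs M) (guarded⇒unfolds (guarded M)))

  canStep?ᵘ : ∀ k P → Unfolds k P → Dec (CanStep P)
  canStep?ᵘ k 𝟘 _ = no λ ()
  canStep?ᵘ k 𝟙 _ = no λ ()
  canStep?ᵘ k (pre a P) _ = yes (a , P , refl , refl)
  canStep?ᵘ k (P ⊙ Q) (u , v) with canStep?ᵘ k P u | term?ᵘ k P u | canStep?ᵘ k Q v
  ... | yes (a , P' , s) | _     | _     = yes (a , P' ⊙ Q , inj₁ (P' , s , refl))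
  ... | no ¬p            | yes t | yes q = yes (canStep-⊙ {P} ¬p t q)
  ... | no ¬p            | no ¬t | _     =
    no λ { (_ , _ , inj₁ (P' , s , _)) → ¬p (_ , P' , s) ; (_ , _ , inj₂ (t , _)) → ¬t t }
  ... | no ¬p            | yes _ | no ¬q =
    no λ { (_ , _ , inj₁ (P' , s , _)) → ¬p (_ , P' , s) ; (_ , _ , inj₂ (_ , _ , s)) → ¬q (_ , _ , s) }
  canStep?ᵘ k (P ⊕ Q) (u , v) with canStep?ᵘ k P u | canStep?ᵘ k Q v
  ... | yes (a , P' , s) | _                = yes (a , P' , inj₁ s)
  ... | no _             | yes (a , Q' , s) = yes (a , Q' , inj₂ s)
  ... | no ¬p            | no ¬q            =
    no λ { (_ , _ , inj₁ s) → ¬p (_ , _ , s) ; (_ , _ , inj₂ s) → ¬q (_ , _ , s) }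
  canStep?ᵘ zero (name M) ()
  canStep?ᵘ (suc k) (name M) _ =
    map′ (map₂ (map₂ (from (stepG⇔step (guarded M))))) (map₂ (map₂ (to (stepG⇔step (guarded M)))))
         (canStep?ᵘ k (rhs M) (guarded⇒unfolds (guarded M)))

  term? : ∀ P → Dec (Term P)
  term? P = term?ᵘ 1 P (unfolds-suc P)

  inert? : ∀ P → Dec (Inert P)
  inert? P = map′ (λ ¬s a P' s → ¬s (a , P' , s)) (λ i (a , P' , s) → i a P' s)
                  (¬? (canStep?ᵘ 1 P (unfolds-suc P)))

  dead? : ∀ P → Dec (Dead P)
  dead? P = term? P ×-dec inert? P

  dead-⊙ : ∀ {P Q} → Dead P → Dead Q → Dead (P ⊙ Q)
  dead-⊙ (tp , ip) (tq , iq) = (tp , tq) , λ where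
    a _ (inj₁ (P' , s , _)) → ip a P' s
    a R (inj₂ (_ , _ , s))  → iq a R s

  dead-⊙⇒deadˡ : ∀ {P Q} → Dead (P ⊙ Q) → Dead P
  dead-⊙⇒deadˡ ((tp , _) , i) = tp , λ a P' s → i a _ (inj₁ (P' , s , refl))

  dead-⊙⇒deadʳ : ∀ {P Q} → Dead P → Dead (P ⊙ Q) → Dead Q
  dead-⊙⇒deadʳ (tp , ip) ((_ , tq) , i) = tq , λ a Q' s → i a Q' (inj₂ (tp , ip , s))

  Symbol : Set
  Symbol = Fin n ⊎ Σ (Fin n) (λ M → Pos (rhs M))

  ⟦_⟧ : Symbol → Exp A n
  ⟦ inj₁ M ⟧       = name M
  ⟦ inj₂ (M , q) ⟧ = subterm q

  symbols : List Symbol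
  symbols = map inj₁ (allFin n)
         ++ map inj₂ (concatMap (λ M → map (M ,_) (positions (rhs M))) (allFin n))

  ∈-symbols : ∀ x → x ∈ symbols
  ∈-symbols (inj₁ M) = ∈-++⁺ˡ (∈-map⁺ inj₁ (∈-allFin M))
  ∈-symbols (inj₂ (M , q)) = ∈-++⁺ʳ (map inj₁ (allFin n)) (∈-map⁺ inj₂
    (∈-concatMap⁺ (λ M → map (M ,_) (positions (rhs M)))
                  (lose (∈-allFin M) (∈-map⁺ (M ,_) (∈-positions q)))))

  -- The expression is the sequential composition of the stack's symbols,
  -- read from the top, with dead components omitted.
  data Represents : Exp A n → List Symbol → Set where
    empty  : ∀ {P} → Dead P → Represents P []
    single : ∀ {x} → ¬ Dead ⟦ x ⟧ → Represents ⟦ x ⟧ (x ∷ [])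
    seq    : ∀ {P Q s t u} → Represents P s → Represents Q t → u ≡ s ++ t →
             Represents (P ⊙ Q) u

  represents-[]⇒dead : ∀ {P} → Represents P [] → Dead P
  represents-[]⇒dead (empty d) = d
  represents-[]⇒dead (seq {P} {Q} {[]} {[]} r r' refl) =
    dead-⊙ {P} {Q} (represents-[]⇒dead r) (represents-[]⇒dead r')

  represents-∷⇒live : ∀ {P x ss} → Represents P (x ∷ ss) → ¬ Dead P
  represents-∷⇒live (single ¬d) = ¬d
  represents-∷⇒live (seq {P} {Q} {[]} r r' refl) d =
    represents-∷⇒live r' (dead-⊙⇒deadʳ {P} {Q} (represents-[]⇒dead r) d)
  represents-∷⇒live (seq {P} {Q} {_ ∷ _} r _ refl) d =
    represents-∷⇒live r (dead-⊙⇒deadˡ {P} {Q} d)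

  StackOf : Exp A n → Set
  StackOf P = Σ (List Symbol) (Represents P)

  represent : (x : Symbol) → StackOf ⟦ x ⟧
  represent x with dead? ⟦ x ⟧
  ... | yes d = [] , empty d
  ... | no ¬d = x ∷ [] , single ¬d

  SubtermStacks : Exp A n → Set
  SubtermStacks P = (q : Pos P) → StackOf (subterm q)

  subtermStacks : (x : Symbol) → SubtermStacks ⟦ x ⟧
  subtermStacks (inj₁ M) here = represent (inj₁ M)
  subtermStacks (inj₂ (M , q)) r = subst StackOf (subterm-⨾ q r) (represent (inj₂ (M , q ⨾ r)))

  Move : Set
  Move = Act A × List Symbol

  record Describes (P : Exp A n) (ms : List Move) : Set where
    field
      complete : ∀ {a P'} → Step P a P' → Σ (List Symbol) λ δ → (a , δ) ∈ ms × Represents P' δ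
      sound    : ∀ {a δ} → (a , δ) ∈ ms → Σ (Exp A n) λ P' → Step P a P' × Represents P' δ
  open Describes

  describes-𝟘 : Describes 𝟘 []
  describes-𝟘 = record { complete = λ () ; sound = λ () }

  describes-𝟙 : Describes 𝟙 []
  describes-𝟙 = record { complete = λ () ; sound = λ () }

  describes-pre : ∀ {a P δ} → Represents P δ → Describes (pre a P) ((a , δ) ∷ [])
  describes-pre r = record
    { complete = λ { (refl , refl) → _ , here refl , r }
    ; sound    = λ { (here refl) → _ , (refl , refl) , r }
    }

  describes-⊕ : ∀ {P Q ms ns} → Describes P ms → Describes Q ns → Describes (P ⊕ Q) (ms ++ ns)
  describes-⊕ {ms = ms} dP dQ = record
    { complete = λ where
        (inj₁ s) → map₂ (map₁ ∈-++⁺ˡ) (complete dP s)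
        (inj₂ s) → map₂ (map₁ (∈-++⁺ʳ ms)) (complete dQ s)
    ; sound = λ m → case ∈-++⁻ ms m of λ where
        (inj₁ m) → map₂ (map₁ inj₁) (sound dP m)
        (inj₂ m) → map₂ (map₁ inj₂) (sound dQ m)
    }

  appendStack : List Symbol → Move → Move
  appendStack ρ (a , δ) = a , δ ++ ρ

  describes-⊙-live : ∀ {P Q ms ρ} → ¬ Dead P → Describes P ms → Represents Q ρ →
                     Describes (P ⊙ Q) (map (appendStack ρ) ms)
  describes-⊙-live {ρ = ρ} ¬d dP rQ = record
    { complete = λ where
        (inj₁ (P' , s , refl)) → let δ , m , r = complete dP s in
          δ ++ ρ , ∈-map⁺ (appendStack ρ) m , seq r rQ refl
        (inj₂ (t , i , _)) → ⊥-elim (¬d (t , i))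
    ; sound = λ m → case ∈-map⁻ (appendStack ρ) m of λ where
        (_ , m' , refl) → let P' , s , r = sound dP m' in
          P' ⊙ _ , inj₁ (P' , s , refl) , seq r rQ refl
    }

  describes-⊙-dead : ∀ {P Q ns} → Dead P → Describes Q ns → Describes (P ⊙ Q) ns
  describes-⊙-dead (t , i) dQ = record
    { complete = λ where
        (inj₁ (P' , s , _)) → ⊥-elim (i _ P' s)
        (inj₂ (_ , _ , s)) → complete dQ s
    ; sound = λ m → map₂ (map₁ (λ s → inj₂ (t , i , s))) (sound dQ m)
    }

  describes-name : ∀ {M ms} → Describes (rhs M) ms → Describes (name M) ms
  describes-name {M} d = record
    { complete = λ s → complete d (to (stepG⇔step (guarded M)) s)
    ; sound    = λ m → map₂ (map₁ (from (stepG⇔step (guarded M)))) (sound d m)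
    }

  derivatives : ∀ k P → Unfolds k P → SubtermStacks P → Σ (List Move) (Describes P)
  derivatives k 𝟘 _ _ = [] , describes-𝟘
  derivatives k 𝟙 _ _ = [] , describes-𝟙
  derivatives k (pre a P) _ σ = let δ , r = σ (under here) in (a , δ) ∷ [] , describes-pre r
  derivatives k (P ⊙ Q) (u , v) σ with dead? P
  ... | yes d = map₂ (describes-⊙-dead d) (derivatives k Q v (λ q → σ (seqʳ q)))
  ... | no ¬d = let ms , dP = derivatives k P u (λ q → σ (seqˡ q))
                    ρ , rQ = σ (seqʳ here)
                in map (appendStack ρ) ms , describes-⊙-live ¬d dP rQ
  derivatives k (P ⊕ Q) (u , v) σ =
    let ms , dP = derivatives k P u (λ q → σ (sumˡ q))
        ns , dQ = derivatives k Q v (λ q → σ (sumʳ q))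
    in ms ++ ns , describes-⊕ dP dQ
  derivatives zero (name M) () _
  derivatives (suc k) (name M) _ _ =
    map₂ describes-name
      (derivatives k (rhs M) (guarded⇒unfolds (guarded M)) (λ q → represent (inj₂ (M , q))))

  moves : Symbol → List Move
  moves x = proj₁ (derivatives 1 ⟦ x ⟧ (unfolds-suc ⟦ x ⟧) (subtermStacks x))

  moves-describe : ∀ x → Describes ⟦ x ⟧ (moves x)
  moves-describe x = proj₂ (derivatives 1 ⟦ x ⟧ (unfolds-suc ⟦ x ⟧) (subtermStacks x))

  step⇒move : ∀ {P x ss a P'} → Represents P (x ∷ ss) → Step P a P' →
              Σ (List Symbol) λ δ → (a , δ) ∈ moves x × Represents P' (δ ++ ss)
  step⇒move {x = x} (single _) s =
    let δ , m , r = complete (moves-describe x) s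
    in δ , m , subst (Represents _) (sym (++-identityʳ δ)) r
  step⇒move (seq {s = []} r _ refl) (inj₁ (_ , s , _)) =
    ⊥-elim (proj₂ (represents-[]⇒dead r) _ _ s)
  step⇒move (seq {s = []} _ r' refl) (inj₂ (_ , _ , s)) = step⇒move r' s
  step⇒move (seq {s = _ ∷ s} {t} r r' refl) (inj₁ (_ , st , refl)) =
    let δ , m , r'' = step⇒move r st
    in δ , m , seq r'' r' (sym (++-assoc δ s t))
  step⇒move (seq {s = _ ∷ _} r _ refl) (inj₂ (t , i , _)) = ⊥-elim (represents-∷⇒live r (t , i))

  move⇒step : ∀ {P x ss a δ} → Represents P (x ∷ ss) → (a , δ) ∈ moves x →
              Σ (Exp A n) λ P' → Step P a P' × Represents P' (δ ++ ss)
  move⇒step {x = x} {δ = δ} (single _) m =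
    let P' , s , r = sound (moves-describe x) m
    in P' , s , subst (Represents P') (sym (++-identityʳ δ)) r
  move⇒step (seq {s = []} r r' refl) m =
    let P' , s , r'' = move⇒step r' m
        t , i = represents-[]⇒dead r
    in P' , inj₂ (t , i , s) , r''
  move⇒step {δ = δ} (seq {Q = Q} {s = _ ∷ s} {t} r r' refl) m =
    let P' , st , r'' = move⇒step r m
    in P' ⊙ Q , inj₁ (P' , st , refl) , seq r'' r' (sym (++-assoc δ s t))

  -- allTerm ss b: every symbol of ss terminates, and so does what lies below ss (b).
  allTerm : List Symbol → Bool → Bool
  allTerm ss b = foldr (λ x → isYes (term? ⟦ x ⟧) ∧_) b ss

  T-allTerm : ∀ {P ss b} → Represents P ss → T (allTerm ss b) ⇔ (Term P × T b)
  T-allTerm (empty (t , _)) = mk⇔ (t ,_) proj₂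
  T-allTerm (single {x} _) =
    mk⇔ (λ t → map₁ toWitness (to T-∧ t)) (λ t → from T-∧ (map₁ (fromWitness {a? = term? ⟦ x ⟧}) t))
  T-allTerm {b = b} (seq {s = s} {t} r r' refl) = mk⇔
    (λ a → let tp , rest = to (T-allTerm r) (subst T (foldr-++ _ b s t) a)
               tq , tb = to (T-allTerm r') rest
           in (tp , tq) , tb)
    (λ ((tp , tq) , tb) → subst T (sym (foldr-++ _ b s t))
                            (from (T-allTerm r) (tp , from (T-allTerm r') (tq , tb))))

  annotatedSymbols : List (Symbol × Bool)
  annotatedSymbols = cartesianProduct symbols (true ∷ false ∷ [])

  ∈-annotatedSymbols : ∀ xb → xb ∈ annotatedSymbols
  ∈-annotatedSymbols (x , b) = ∈-cartesianProduct⁺ (∈-symbols x) (∈-booleans b)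

  open Enumeration annotatedSymbols ∈-annotatedSymbols

  StackSymbol : Set
  StackSymbol = Fin (length annotatedSymbols)

  encodeStack : List Symbol → Bool → List StackSymbol
  encodeStack []       b = []
  encodeStack (x ∷ ss) b = encode (x , allTerm ss b) ∷ encodeStack ss b

  encodeStack-++ : ∀ δ ss b →
                   encodeStack (δ ++ ss) b ≡ encodeStack δ (allTerm ss b) ++ encodeStack ss b
  encodeStack-++ []      ss b = refl
  encodeStack-++ (x ∷ δ) ss b =
    cong₂ _∷_ (cong (λ b′ → encode (x , b′)) (foldr-++ _ b δ ss)) (encodeStack-++ δ ss b)

  state : Bool → Fin 2
  state true  = zero
  state false = suc zero

  state-accepting : ∀ {b} → state b ∈ₛ ⁅ zero ⁆ ⇔ T b
  state-accepting {true}  = mk⇔ (λ _ → tt) (λ _ → x∈⁅x⁆ zero)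
  state-accepting {false} = mk⇔ (λ p → case x∈⁅y⁆⇒x≡y zero p of λ ()) (λ ())

  Transition : Set
  Transition = Fin 2 × StackSymbol × Act A × List StackSymbol × Fin 2

  rule : Fin 2 → Symbol × Bool → Move → Transition
  rule s (x , b) (a , δ) = s , encode (x , b) , a , encodeStack δ b , state (allTerm δ b)

  rulesFor : Fin 2 → Symbol × Bool → List Transition
  rulesFor s (x , b) = map (rule s (x , b)) (moves x)

  rulesFrom : Fin 2 → List Transition
  rulesFrom s = concatMap (rulesFor s) annotatedSymbols

  rules : List Transition
  rules = concatMap rulesFrom (allFin 2)

  ∈-rules : ∀ s x b {m} → m ∈ moves x → rule s (x , b) m ∈ rules
  ∈-rules s x b m∈ = ∈-concatMap⁺ rulesFrom (lose (∈-allFin s)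
    (∈-concatMap⁺ (rulesFor s) (lose (∈-annotatedSymbols (x , b)) (∈-map⁺ (rule s (x , b)) m∈))))

  ∈-rules⁻ : ∀ {tr} → tr ∈ rules →
             Σ (Fin 2) λ s → Σ Symbol λ x → Σ Bool λ b → Σ Move λ m →
               m ∈ moves x × tr ≡ rule s (x , b) m
  ∈-rules⁻ tr∈ =
    let s , _ , tr∈ₛ = find (∈-concatMap⁻ rulesFrom {xs = allFin 2} tr∈)
        (x , b) , _ , tr∈ₓ = find (∈-concatMap⁻ (rulesFor s) {xs = annotatedSymbols} tr∈ₛ)
        m , m∈ , eq = ∈-map⁻ (rule s (x , b)) tr∈ₓ
    in s , x , b , m , m∈ , eq

  config : List Symbol → Fin 2 × List StackSymbol
  config ss = state (allTerm ss true) , encodeStack ss true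

  config-++ : ∀ δ ss → config (δ ++ ss) ≡
              (state (allTerm δ (allTerm ss true)) , encodeStack δ (allTerm ss true) ++ encodeStack ss true)
  config-++ δ ss = cong₂ _,_ (cong state (foldr-++ _ true δ ss)) (encodeStack-++ δ ss true)

  module Automaton (N : Fin n) where

    pda : PDA A
    pda = record { nS = 2 ; nD = length annotatedSymbols ; trans = rules
                 ; init = state (allTerm (inj₁ N ∷ []) true) ; Z = encode (inj₁ N , true)
                 ; accept = ⁅ zero ⁆ }

    open LTS (𝒯ᴾ pda) using (Trans)

    move⇒transition : ∀ {x ss a δ} → (a , δ) ∈ moves x → Trans (config (x ∷ ss)) a (config (δ ++ ss))
    move⇒transition {x} {ss} {a} {δ} m∈ = subst (Trans (config (x ∷ ss)) a) (sym (config-++ δ ss))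
      (_ , _ , _ , refl , ∈-rules _ x (allTerm ss true) m∈ , refl)

    transition⇒move : ∀ {ss a c} → Trans (config ss) a c →
                      Σ Symbol λ x → Σ (List Symbol) λ rest → Σ (List Symbol) λ δ →
                        ss ≡ x ∷ rest × (a , δ) ∈ moves x × c ≡ config (δ ++ rest)
    transition⇒move {ss} {c = _ , _} (_ , _ , _ , e , tr∈ , refl) with ∈-rules⁻ tr∈
    ... | _ , x , b , (_ , δ) , m∈ , refl with ss | e
    ...   | x′ ∷ rest | e′ with ∷-injective e′
    ...     | enc≡ , refl with encode-injective enc≡
    ...       | refl = x , rest , δ , refl , m∈ , sym (config-++ δ rest)

    _∼_ : Exp A n → Fin 2 × List StackSymbol → Set
    P ∼ c = Σ (List Symbol) λ ss → Represents P ss × c ≡ config ss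

    bisimulation : IsBisimulation (𝒯 E N) (𝒯ᴾ pda) _∼_
    bisimulation = record { zig = zig ; zag = zag ; termˡ = termˡ ; termʳ = termʳ }
      where
      zig : ∀ {P c a P'} → P ∼ c → Step P a P' → Σ _ λ c' → Trans c a c' × P' ∼ c'
      zig ([] , r , refl) s = ⊥-elim (proj₂ (represents-[]⇒dead r) _ _ s)
      zig (x ∷ rest , r , refl) s =
        let δ , m∈ , r′ = step⇒move r s
        in config (δ ++ rest) , move⇒transition m∈ , (δ ++ rest , r′ , refl)

      zag : ∀ {P c a c'} → P ∼ c → Trans c a c' → Σ (Exp A n) λ P' → Step P a P' × P' ∼ c'
      zag (ss , r , refl) t with transition⇒move t
      ... | x , rest , δ , refl , m∈ , refl =
        let P' , s , r′ = move⇒step r m∈ in P' , s , (δ ++ rest , r′ , refl)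

      termˡ : ∀ {P c} → P ∼ c → Term P → proj₁ c ∈ₛ ⁅ zero ⁆
      termˡ (_ , r , refl) t = from state-accepting (from (T-allTerm r) (t , tt))

      termʳ : ∀ {P c} → P ∼ c → proj₁ c ∈ₛ ⁅ zero ⁆ → Term P
      termʳ (_ , r , refl) f = proj₁ (to (T-allTerm r) (to state-accepting f))

    bisimilar : ¬ Dead (name N) → Bisimilar (𝒯 E N) (𝒯ᴾ pda)
    bisimilar ¬d = _∼_ , bisimulation , (inj₁ N ∷ [] , single ¬d , refl)

theorem2 : {A : Set} {n : ℕ} (E : GuardedSpec A n) (N : Fin n) →
             Σ (PDA A) λ M → Bisimilar (𝒯 E N) (𝒯ᴾ M)
theorem2 E N with Construction.dead? E (name N)
... | yes (t , i) = inert-bisimilar (𝒯 E N) (λ s → i _ _ s) (yes t)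
... | no ¬d       = Automaton.pda , Automaton.bisimilar ¬d
  where module Automaton = Construction.Automaton E N
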